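{- Let $G$ be a subcubic graph, $\pi=\{V_1,\dots,V_k\}$ a connected coalition partition of $G$, and $H=CCG(G,\pi)$. If $k\le 4$, then $H$ is isomorphic to one of the graphs $K_1$, $K_2$, $\overline{K}_2$, $P_3$, $K_3$, $\overline{K}_3$, $2K_2$, $S_4$, $P_4$, $C_4$, $C_3+e$, $K_4-e$, $K_4$, $\overline{K}_4$.
   Context: Graphs are finite and simple. A graph is subcubic if it is connected and its maximum vertex degree is at most 3. $G[S]$ is the induced subgraph. A set $D\subseteq V$ is dominating if every vertex of $V\setminus D$ has a neighbour in $D$; connected dominating if moreover $G[D]$ is connected. Two disjoint subsets $A,B\subseteq V$ form a connected coalition if neither is a connected dominating set but $A\cup B$ is. A connected coalition partition of $G$ is a partition $\pi=\{V_1,\dots,V_k\}$ of $V$ such that each $V_i$ either is a connected dominating set consisting of a single vertex or forms a connected coalition with some set of $\pi$. The coalition graph $CCG(G,\pi)$ has vertex set $\{V_1,\dots,V_k\}$, with $V_i\sim V_j$ iff they form a connected coalition. $\overline{K}_n$ is the edgeless graph on $n$ vertices; $2K_2$ is two disjoint edges; $S_4=K_{1,3}$; $C_3+e$ is a triangle with one pendant vertex attached; $K_4-e$ is $K_4$ minus an edge. -}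

module Defs where

open import Data.Nat using (ℕ; zero; suc; _≤_)
open import Data.Bool using (Bool; true; false; _∨_; _∧_)
open import Data.Fin using (Fin; zero; suc; _≟_)
open import Data.Fin.Subset using (Subset; _∈_; _∉_; _∪_; ∣_∣; Nonempty; ⊤)
open import Data.Vec using (tabulate)
open import Data.List using (List; []; _∷_)
open import Data.List.Relation.Unary.Any using (Any)
open import Data.Product using (Σ; ∃; _×_; _,_)
open import Data.Sum using (_⊎_)
open import Relation.Nullary using (¬_; does)
open import Relation.Binary.PropositionalEquality using (_≡_; _≢_)
open import Function.Bundles using (_↔_; _⇔_; Inverse)

record Graph (n : ℕ) : Set where
  field
    adj   : Fin n → Fin n → Bool
    sym   : ∀ u v → adj u v ≡ adj v u
    irrefl : ∀ v → adj v v ≡ false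
open Graph public

module _ {n : ℕ} (G : Graph n) where

  data WalkIn (S : Subset n) : Fin n → Fin n → Set where
    here : ∀ {v} → v ∈ S → WalkIn S v v
    step : ∀ {u w v} → u ∈ S → adj G u w ≡ true → WalkIn S w v → WalkIn S u v

  -- G[S] is connected (a connected graph is nonempty)
  InducedConnected : Subset n → Set
  InducedConnected S = Nonempty S × (∀ u v → u ∈ S → v ∈ S → WalkIn S u v)

  Connected : Set
  Connected = InducedConnected ⊤

  N : Fin n → Subset n
  N v = tabulate (λ u → adj G v u)

  deg : Fin n → ℕ
  deg v = ∣ N v ∣

  Subcubic : Set
  Subcubic = Connected × (∀ v → deg v ≤ 3)

  Dominating : Subset n → Set
  Dominating D = ∀ v → v ∉ D → ∃ λ u → u ∈ D × adj G v u ≡ true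

  ConnDominating : Subset n → Set
  ConnDominating D = Dominating D × InducedConnected D

  -- A and B disjoint form a connected coalition
  -- (disjointness is guaranteed below since they are distinct parts of a partition)
  ConnCoalition : Subset n → Subset n → Set
  ConnCoalition A B = ¬ ConnDominating A × ¬ ConnDominating B × ConnDominating (A ∪ B)

  -- A partition of V(G) into k (nonempty) classes V_0,…,V_{k-1}, given by the
  -- class map; surjectivity = every class is nonempty.
  record Partition (k : ℕ) : Set where
    field
      cls  : Fin n → Fin k
      surj : ∀ i → ∃ λ v → cls v ≡ i
  open Partition public

  part : ∀ {k} → Partition k → Fin k → Subset n
  part π i = tabulate (λ v → does (cls π v ≟ i))

  CCGAdj : ∀ {k} → Partition k → Fin k → Fin k → Set
  CCGAdj π i j = i ≢ j × ConnCoalition (part π i) (part π j)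

  IsConnCoalitionPartition : ∀ {k} → Partition k → Set
  IsConnCoalitionPartition π =
    ∀ i → (ConnDominating (part π i) × ∣ part π i ∣ ≡ 1)
          ⊎ (∃ λ j → i ≢ j × ConnCoalition (part π i) (part π j))

edgesAdj : ∀ {m} → List (Fin m × Fin m) → Fin m → Fin m → Bool
edgesAdj [] u v = false
edgesAdj ((a , b) ∷ es) u v =
  (does (a ≟ u) ∧ does (b ≟ v)) ∨ (does (a ≟ v) ∧ does (b ≟ u)) ∨ edgesAdj es u v

SmallGraph : Set
SmallGraph = Σ ℕ λ m → List (Fin m × Fin m)

IsoTo : ∀ {k} → (Fin k → Fin k → Set) → SmallGraph → Set
IsoTo {k} R (m , es) =
  Σ (Fin k ↔ Fin m) λ f →
    ∀ i j → R i j ⇔ (edgesAdj es (Inverse.to f i) (Inverse.to f j) ≡ true)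

private
  v0 : Fin 4
  v0 = zero
  v1 : Fin 4
  v1 = suc zero
  v2 : Fin 4
  v2 = suc (suc zero)
  v3 : Fin 4
  v3 = suc (suc (suc zero))

K1 K2 K̄2 P3 K3 K̄3 2K2 S4 P4 C4 C3+e K4-e K4 K̄4 : SmallGraph
K1   = 1 , []
K2   = 2 , (zero , suc zero) ∷ []
K̄2   = 2 , []
P3   = 3 , (zero , suc zero) ∷ (suc zero , suc (suc zero)) ∷ []
K3   = 3 , (zero , suc zero) ∷ (suc zero , suc (suc zero)) ∷ (zero , suc (suc zero)) ∷ []
K̄3   = 3 , []
2K2  = 4 , (v0 , v1) ∷ (v2 , v3) ∷ []
S4   = 4 , (v0 , v1) ∷ (v0 , v2) ∷ (v0 , v3) ∷ []
P4   = 4 , (v0 , v1) ∷ (v1 , v2) ∷ (v2 , v3) ∷ []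
C4   = 4 , (v0 , v1) ∷ (v1 , v2) ∷ (v2 , v3) ∷ (v3 , v0) ∷ []
C3+e = 4 , (v0 , v1) ∷ (v1 , v2) ∷ (v2 , v0) ∷ (v2 , v3) ∷ []
K4-e = 4 , (v0 , v1) ∷ (v1 , v2) ∷ (v2 , v3) ∷ (v3 , v0) ∷ (v0 , v2) ∷ []
K4   = 4 , (v0 , v1) ∷ (v1 , v2) ∷ (v2 , v3) ∷ (v3 , v0) ∷ (v0 , v2) ∷ (v1 , v3) ∷ []
K̄4   = 4 , []

allowedCCGs : List SmallGraph
allowedCCGs = K1 ∷ K2 ∷ K̄2 ∷ P3 ∷ K3 ∷ K̄3 ∷ 2K2 ∷ S4 ∷ P4 ∷ C4 ∷ C3+e ∷ K4-e ∷ K4 ∷ K̄4 ∷ []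

module Submission where

-- A class that is isolated in the coalition graph must be a singleton connected dominating
-- set {c}, so c is adjacent to every other vertex and, having degree at most 3, G has at most
-- four vertices. Were two classes V_j, V_l nevertheless in coalition, V_j ∪ V_l would be a
-- connected dominating set of at least two vertices avoiding c; on at most four vertices such
-- a set contains a vertex adjacent to all others, which alone makes its own class connected
-- dominating. So the coalition graph has no isolated vertex or no edge, and on one to four
-- vertices the graphs of that kind are exactly the fourteen listed ones (exhaustive search).

open import Defs
open import Data.Nat using (ℕ; zero; suc; _≤_; _<_; s≤s; z≤n; s≤s⁻¹)
open import Data.Nat.Properties using (<-≤-trans; ≤-<-trans; n≮0; <⇒≱)
open import Data.Bool using (Bool; true; false; T; _∧_)
import Data.Bool.Properties as Bool
open import Data.Fin using (Fin; zero; suc; _≟_)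
open import Data.Fin.Properties using (all?; any?; toℕ<n)
open import Data.Fin.Permutation using (Permutation; Permutation′; _⟨$⟩ʳ_; id; insert)
open import Data.Fin.Subset using (Subset; _∈_; _∉_; _∪_; _-_; ⁅_⁆; ∣_∣)
open import Data.Fin.Subset.Properties
  using (_∈?_; nonempty?; ∣p∣≤n; x∈p⇒∣p-x∣<∣p∣; x∈p∧x≢y⇒x∈p-y; p─q⊆p; ∪-comm; x∈p∪q⁻; x∈p∪q⁺)
open import Data.List using (List; []; _∷_; length; allFin; cartesianProductWith)
open import Data.List.Relation.Unary.All using (All; []; _∷_)
import Data.List.Relation.Unary.All as All
open import Data.List.Relation.Unary.AllPairs using ([]; _∷_)
open import Data.List.Relation.Unary.Any using (Any; here; there; satisfied)
import Data.List.Relation.Unary.Any as Any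
open import Data.List.Relation.Unary.Unique.Propositional using (Unique)
open import Data.Maybe using (Maybe; nothing; _<∣>_; is-just; to-witness-T)
import Data.Maybe as Maybe
open import Data.Vec using (_∷_; tabulate; here; there)
open import Data.Vec.Properties using (lookup⇒[]=; []=⇒lookup; lookup∘tabulate)
import Data.Vec.Functional as Row
open import Data.Product using (Σ; ∃; ∃₂; _×_; _,_; proj₁; proj₂)
open import Data.Sum using (_⊎_; inj₁; inj₂)
open import Data.Empty using (⊥; ⊥-elim)
open import Data.Unit using (tt)
open import Function using (_∘_; _$_)
open import Function.Bundles using (Equivalence; _⇔_; mk⇔)
open import Relation.Binary.PropositionalEquality using (_≡_; _≢_; _≗_; refl; trans; subst; ≢-sym)
import Relation.Binary.PropositionalEquality as ≡
open import Relation.Nullary using (Dec; yes; no; does; ¬_; ¬?)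
open import Relation.Nullary.Decidable
  using (_×-dec_; _→-dec_; map′; dec-true; dec-false; does-⇔; dec⇒maybe)
import Data.Nat as ℕ

x∉p-x : ∀ {n} (p : Subset n) x → x ∉ p - x
x∉p-x (_ ∷ _) zero    ()
x∉p-x (_ ∷ p) (suc x) (there x∈p-x) = x∉p-x p x x∈p-x

∈∧∉⇒≢ : ∀ {n} {p : Subset n} {x y} → x ∈ p → y ∉ p → x ≢ y
∈∧∉⇒≢ x∈p y∉p refl = y∉p x∈p

∈-tabulate⁺ : ∀ {n} (f : Fin n → Bool) {v} → f v ≡ true → v ∈ tabulate f
∈-tabulate⁺ f {v} fv = lookup⇒[]= v (tabulate f) (trans (lookup∘tabulate f v) fv)

∈-tabulate⁻ : ∀ {n} (f : Fin n → Bool) {v} → v ∈ tabulate f → f v ≡ true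
∈-tabulate⁻ f {v} v∈f = trans (≡.sym (lookup∘tabulate f v)) ([]=⇒lookup v∈f)

does≡true⇒ : ∀ {A : Set} (a? : Dec A) → does a? ≡ true → A
does≡true⇒ (yes a) _ = a

does≡false⇒¬ : ∀ {A : Set} (a? : Dec A) → does a? ≡ false → ¬ A
does≡false⇒¬ (no ¬a) _ = ¬a

Unique⇒length≤∣p∣ : ∀ {n} {p : Subset n} {xs} → Unique xs → All (_∈ p) xs → length xs ≤ ∣ p ∣
Unique⇒length≤∣p∣ []                  []            = z≤n
Unique⇒length≤∣p∣ (x≢xs ∷ xs!) (x∈p ∷ xs∈p) =
  <-≤-trans (s≤s (Unique⇒length≤∣p∣ xs! (All.zipWith (λ (x≢y , y∈p) → x∈p∧x≢y⇒x∈p-y y∈p (≢-sym x≢y)) (x≢xs , xs∈p))))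
            (x∈p⇒∣p-x∣<∣p∣ x∈p)

∣p∣≡1⇒x≡y : ∀ {n} {p : Subset n} → ∣ p ∣ ≡ 1 → ∀ {x y} → x ∈ p → y ∈ p → x ≡ y
∣p∣≡1⇒x≡y ∣p∣≡1 {x} {y} x∈p y∈p with x ≟ y
... | yes x≡y = x≡y
... | no x≢y
  with subst (2 ≤_) ∣p∣≡1 (Unique⇒length≤∣p∣ ((x≢y ∷ []) ∷ [] ∷ []) (x∈p ∷ y∈p ∷ []))
...   | s≤s ()

module _ {n : ℕ} (G : Graph n) where

  adj-sym : ∀ {u v} → adj G u v ≡ true → adj G v u ≡ true
  adj-sym {u} {v} u~v = trans (sym G v u) u~v

  adj⇒≢ : ∀ {u v} → adj G u v ≡ true → u ≢ v
  adj⇒≢ {u} u~u refl with trans (≡.sym u~u) (irrefl G u)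
  ... | ()

  walk-head : ∀ {S u v} → WalkIn G S u v → u ∈ S
  walk-head (here u∈S)     = u∈S
  walk-head (step u∈S _ _) = u∈S

  walk-mono : ∀ {S T u v} → (∀ {x} → x ∈ S → x ∈ T) → WalkIn G S u v → WalkIn G T u v
  walk-mono S⊆T (here u∈S)          = here (S⊆T u∈S)
  walk-mono S⊆T (step u∈S u~w walk) = step (S⊆T u∈S) u~w (walk-mono S⊆T walk)

  walk-first-step : ∀ {S u v} → WalkIn G S u v → u ≢ v → ∃ λ w → w ∈ S × adj G u w ≡ true
  walk-first-step (here _)          u≢u = ⊥-elim (u≢u refl)
  walk-first-step (step _ u~w walk) _   = _ , walk-head walk , u~w

  walk-avoids-or-leaves : ∀ {S x v} u → u ≢ v → WalkIn G S x v →
                  WalkIn G (S - u) x v ⊎ ∃ λ w → adj G u w ≡ true × WalkIn G (S - u) w v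
  walk-avoids-or-leaves u u≢v (here v∈S) = inj₁ (here (x∈p∧x≢y⇒x∈p-y v∈S (≢-sym u≢v)))
  walk-avoids-or-leaves u u≢v (step {u = x} x∈S x~y walk) with walk-avoids-or-leaves u u≢v walk
  ... | inj₂ exit = inj₂ exit
  ... | inj₁ walk′ with x ≟ u
  ...   | yes refl = inj₂ (_ , x~y , walk′)
  ...   | no x≢u   = inj₁ (step (x∈p∧x≢y⇒x∈p-y x∈S x≢u) x~y walk′)

  walk-leaves : ∀ {S u v} → u ≢ v → WalkIn G S u v → ∃ λ w → adj G u w ≡ true × WalkIn G (S - u) w v
  walk-leaves {S} {u} u≢v walk with walk-avoids-or-leaves u u≢v walk
  ... | inj₁ walk′ = ⊥-elim (x∉p-x S u (walk-head walk′))
  ... | inj₂ exit  = exit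

  walk? : ∀ m S → ∣ S ∣ ≤ m → ∀ u v → Dec (WalkIn G S u v)
  walk? m S ∣S∣≤m u v with u ∈? S | u ≟ v
  ... | no u∉S  | _        = no (u∉S ∘ walk-head)
  ... | yes u∈S | yes refl = yes (here u∈S)
  walk? zero    S ∣S∣≤0 u v | yes u∈S | no _ = ⊥-elim (n≮0 (<-≤-trans (x∈p⇒∣p-x∣<∣p∣ u∈S) ∣S∣≤0))
  walk? (suc m) S ∣S∣≤m u v | yes u∈S | no u≢v =
    map′ (λ (w , u~w , walk) → step u∈S u~w (walk-mono (p─q⊆p S ⁅ u ⁆) walk))
         (walk-leaves u≢v)
         (any? λ w → (adj G u w Bool.≟ true) ×-dec walk? m (S - u) ∣S-u∣≤m w v)
    where
    ∣S-u∣≤m : ∣ S - u ∣ ≤ m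
    ∣S-u∣≤m = s≤s⁻¹ (<-≤-trans (x∈p⇒∣p-x∣<∣p∣ u∈S) ∣S∣≤m)

  inducedConnected? : ∀ S → Dec (InducedConnected G S)
  inducedConnected? S = nonempty? S ×-dec
    all? λ u → all? λ v → u ∈? S →-dec (v ∈? S →-dec walk? n S (∣p∣≤n S) u v)

  dominating? : ∀ D → Dec (Dominating G D)
  dominating? D = all? λ v → ¬? (v ∈? D) →-dec any? λ u → u ∈? D ×-dec (adj G v u Bool.≟ true)

  connDominating? : ∀ D → Dec (ConnDominating G D)
  connDominating? D = dominating? D ×-dec inducedConnected? D

  Universal : Fin n → Set
  Universal c = ∀ v → v ≢ c → adj G c v ≡ true

  universal⇒connDominating : ∀ {c D} → Universal c → c ∈ D → ConnDominating G D
  universal⇒connDominating {c} {D} c-univ c∈D = dominated , (c , c∈D) , connected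
    where
    dominated : Dominating G D
    dominated v v∉D = c , c∈D , adj-sym (c-univ v λ { refl → v∉D c∈D })
    from-c : ∀ v → v ∈ D → WalkIn G D c v
    from-c v v∈D with v ≟ c
    ... | yes refl = here c∈D
    ... | no v≢c   = step c∈D (c-univ v v≢c) (here v∈D)
    connected : ∀ u v → u ∈ D → v ∈ D → WalkIn G D u v
    connected u v u∈D v∈D with u ≟ c
    ... | yes refl = from-c v v∈D
    ... | no u≢c   = step u∈D (adj-sym (c-univ u u≢c)) (from-c v v∈D)

  singleton-dominating⇒universal : ∀ {D c} → Dominating G D → ∣ D ∣ ≡ 1 → c ∈ D → Universal c
  singleton-dominating⇒universal {D} dominated ∣D∣≡1 c∈D v v≢c with v ∈? D
  ... | yes v∈D = ⊥-elim (v≢c (∣p∣≡1⇒x≡y ∣D∣≡1 v∈D c∈D))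
  ... | no v∉D with dominated v v∉D
  ...   | u , u∈D , v~u = adj-sym (subst (λ u → adj G v u ≡ true) (∣p∣≡1⇒x≡y ∣D∣≡1 u∈D c∈D) v~u)

  connDominating⇒total : ∀ {D a b} → ConnDominating G D → a ∈ D → b ∈ D → a ≢ b →
                         ∀ d → ∃ λ y → y ∈ D × adj G d y ≡ true
  connDominating⇒total {D} {a} {b} (dominated , _ , connected) a∈D b∈D a≢b d with d ∈? D | d ≟ a
  ... | no d∉D  | _        = dominated d d∉D
  ... | yes d∈D | yes refl = walk-first-step (connected d b d∈D b∈D) a≢b
  ... | yes d∈D | no d≢a   = walk-first-step (connected d a d∈D a∈D) d≢a

  module _ {c} (c-univ : Universal c) (deg-c≤3 : deg G c ≤ 3) where

    no-four-others : ∀ {p q r s} → Unique (p ∷ q ∷ r ∷ s ∷ []) → All (_≢ c) (p ∷ q ∷ r ∷ s ∷ []) → ⊥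
    no-four-others distinct others =
      <⇒≱ (s≤s deg-c≤3) (Unique⇒length≤∣p∣ distinct (All.map (λ {v} v≢c → ∈-tabulate⁺ (adj G c) (c-univ v v≢c)) others))

    universal-by-two-neighbours : ∀ {x p q} → Unique (x ∷ p ∷ q ∷ []) → All (_≢ c) (x ∷ p ∷ q ∷ []) →
                                  adj G x p ≡ true → adj G x q ≡ true → Universal x
    universal-by-two-neighbours {x} {p} {q} ((x≢p ∷ x≢q ∷ []) ∷ (p≢q ∷ []) ∷ [] ∷ []) (x≢c ∷ p≢c ∷ q≢c ∷ [])
                                x~p x~q v v≢x
      with v ≟ c | v ≟ p | v ≟ q
    ... | yes refl | _        | _        = adj-sym (c-univ x x≢c)
    ... | no _     | yes refl | _        = x~p
    ... | no _     | no _     | yes refl = x~q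
    ... | no v≢c   | no v≢p   | no v≢q   = ⊥-elim $
      no-four-others ((x≢p ∷ x≢q ∷ ≢-sym v≢x ∷ []) ∷ (p≢q ∷ ≢-sym v≢p ∷ []) ∷ (≢-sym v≢q ∷ []) ∷ [] ∷ [])
                     (x≢c ∷ p≢c ∷ q≢c ∷ v≢c ∷ [])

    connDominating-has-universal : ∀ {D a b} → ConnDominating G D → c ∉ D → a ∈ D → b ∈ D → a ≢ b →
                                   ∃ λ x → x ∈ D × Universal x
    connDominating-has-universal {D} {a} cd@(_ , _ , connected) c∉D a∈D b∈D a≢b =
      near-edge (walk-first-step (connected _ _ a∈D b∈D) a≢b)
      where
      ≢c : ∀ {x} → x ∈ D → x ≢ c
      ≢c x∈D = ∈∧∉⇒≢ x∈D c∉D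

      near-edge : (∃ λ w → w ∈ D × adj G a w ≡ true) → ∃ λ x → x ∈ D × Universal x
      near-edge (w , w∈D , a~w) with any? (λ d → ¬? (d ≟ c) ×-dec (¬? (d ≟ a) ×-dec ¬? (d ≟ w)))
      ... | no no-fourth = a , a∈D , a-univ
        where
        a-univ : Universal a
        a-univ v v≢a with v ≟ c | v ≟ w
        ... | yes refl | _        = adj-sym (c-univ a (≢c a∈D))
        ... | no _     | yes refl = a~w
        ... | no v≢c   | no v≢w   = ⊥-elim (no-fourth (v , v≢c , v≢a , v≢w))
      ... | yes (d , d≢c , d≢a , d≢w) with connDominating⇒total cd a∈D w∈D (adj⇒≢ a~w) d
      ...   | y , y∈D , d~y with y ≟ a | y ≟ w
      ...     | yes refl | _ =
        a , a∈D , universal-by-two-neighbours ((adj⇒≢ a~w ∷ ≢-sym d≢a ∷ []) ∷ (≢-sym d≢w ∷ []) ∷ [] ∷ [])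
                                              (≢c a∈D ∷ ≢c w∈D ∷ d≢c ∷ []) a~w (adj-sym d~y)
      ...     | no _ | yes refl =
        w , w∈D , universal-by-two-neighbours ((≢-sym (adj⇒≢ a~w) ∷ ≢-sym d≢w ∷ []) ∷ (≢-sym d≢a ∷ []) ∷ [] ∷ [])
                                              (≢c w∈D ∷ ≢c a∈D ∷ d≢c ∷ []) (adj-sym a~w) (adj-sym d~y)
      ...     | no y≢a | no y≢w = ⊥-elim $
        no-four-others ((adj⇒≢ a~w ∷ ≢-sym d≢a ∷ ≢-sym y≢a ∷ []) ∷ (≢-sym d≢w ∷ ≢-sym y≢w ∷ []) ∷ (adj⇒≢ d~y ∷ []) ∷ [] ∷ [])
                       (≢c a∈D ∷ ≢c w∈D ∷ d≢c ∷ ≢c y∈D ∷ [])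

  module _ {k} (π : Partition G k) where

    ∈part⁺ : ∀ {v i} → cls π v ≡ i → v ∈ part G π i
    ∈part⁺ {v} {i} v↦i = ∈-tabulate⁺ _ (dec-true (cls π v ≟ i) v↦i)

    ∈part⁻ : ∀ {v i} → v ∈ part G π i → cls π v ≡ i
    ∈part⁻ {v} {i} v∈i = does≡true⇒ (cls π v ≟ i) (∈-tabulate⁻ _ v∈i)

    representative : ∀ i → ∃ λ v → v ∈ part G π i
    representative i with surj π i
    ... | v , v↦i = v , ∈part⁺ v↦i

    ccgAdj? : ∀ i j → Dec (CCGAdj G π i j)
    ccgAdj? i j = ¬? (i ≟ j) ×-dec (¬? (connDominating? (part G π i)) ×-dec
                  (¬? (connDominating? (part G π j)) ×-dec connDominating? (part G π i ∪ part G π j)))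

    ccgAdj-sym : ∀ {i j} → CCGAdj G π i j → CCGAdj G π j i
    ccgAdj-sym {i} {j} (i≢j , ¬cd-i , ¬cd-j , cd-i∪j) =
      ≢-sym i≢j , ¬cd-j , ¬cd-i , subst (ConnDominating G) (∪-comm (part G π i) (part G π j)) cd-i∪j

    same-class : ∀ {v i j} → v ∈ part G π i → v ∈ part G π j → i ≡ j
    same-class v∈i v∈j = trans (≡.sym (∈part⁻ v∈i)) (∈part⁻ v∈j)

    no-coalition-avoiding-universal : ∀ {c} → Universal c → deg G c ≤ 3 →
                                      ∀ {j l} → c ∉ part G π j ∪ part G π l → ¬ CCGAdj G π j l
    no-coalition-avoiding-universal c-univ deg-c≤3 {j} {l} c∉j∪l (j≢l , ¬cd-j , ¬cd-l , cd-j∪l)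
      with representative j | representative l
    ... | a , a∈j | b , b∈l
      with connDominating-has-universal c-univ deg-c≤3 cd-j∪l c∉j∪l (x∈p∪q⁺ (inj₁ a∈j)) (x∈p∪q⁺ (inj₂ b∈l))
                                        (λ { refl → j≢l (same-class a∈j b∈l) })
    ...   | x , x∈j∪l , x-univ with x∈p∪q⁻ (part G π j) (part G π l) x∈j∪l
    ...     | inj₁ x∈j = ¬cd-j (universal⇒connDominating x-univ x∈j)
    ...     | inj₂ x∈l = ¬cd-l (universal⇒connDominating x-univ x∈l)

    isolated-class⇒no-coalition : (∀ v → deg G v ≤ 3) → IsConnCoalitionPartition G π →
                                  ∀ {i j l} → (∀ m → ¬ CCGAdj G π i m) → ¬ CCGAdj G π j l
    isolated-class⇒no-coalition deg≤3 coalition-partition {i} {j} {l} i-isolated j~l with coalition-partition i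
    ... | inj₂ (m , i≢m , coalition) = i-isolated m (i≢m , coalition)
    ... | inj₁ ((i-dominating , _) , ∣i∣≡1) with representative i
    ...   | c , c∈i = no-coalition-avoiding-universal
                        (singleton-dominating⇒universal i-dominating ∣i∣≡1 c∈i) (deg≤3 c) c∉j∪l j~l
      where
      c∉j∪l : c ∉ part G π j ∪ part G π l
      c∉j∪l c∈j∪l with x∈p∪q⁻ (part G π j) (part G π l) c∈j∪l
      ... | inj₁ c∈j = i-isolated l (subst (λ t → CCGAdj G π t l) (same-class c∈j c∈i) j~l)
      ... | inj₂ c∈l = i-isolated j (subst (λ t → CCGAdj G π t j) (same-class c∈l c∈i) (ccgAdj-sym j~l))

AdjMatrix : ℕ → Set
AdjMatrix k = Fin k → Fin k → Bool

IsSymmetric : ∀ {k} → AdjMatrix k → Set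
IsSymmetric b = ∀ i j → b i j ≡ b j i

IsLoopless : ∀ {k} → AdjMatrix k → Set
IsLoopless b = ∀ i → b i i ≡ false

_≐_ : ∀ {k} → AdjMatrix k → AdjMatrix k → Set
b ≐ b′ = ∀ i j → b i j ≡ b′ i j

_≅_ : ∀ {k} → AdjMatrix k → SmallGraph → Set
_≅_ {k} b (m , es) = Σ (Permutation k m) λ σ → ∀ i j → b i j ≡ edgesAdj es (σ ⟨$⟩ʳ i) (σ ⟨$⟩ʳ j)

permutations : ∀ k → List (Permutation′ k)
permutations zero    = id ∷ []
permutations (suc k) = cartesianProductWith (insert zero) (allFin (suc k)) (permutations k)

iso? : ∀ {k} (b : AdjMatrix k) g → Maybe (b ≅ g)
iso? {k} b (m , es) with k ℕ.≟ m
... | no _     = nothing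
... | yes refl = Maybe.map satisfied (dec⇒maybe (Any.any? preserves? (permutations k)))
  where
  preserves? : (σ : Permutation′ k) → Dec (∀ i j → b i j ≡ edgesAdj es (σ ⟨$⟩ʳ i) (σ ⟨$⟩ʳ j))
  preserves? σ = all? λ i → all? λ j → b i j Bool.≟ edgesAdj es (σ ⟨$⟩ʳ i) (σ ⟨$⟩ʳ j)

findAny : {A : Set} {P : A → Set} → (∀ x → Maybe (P x)) → ∀ xs → Maybe (Any P xs)
findAny p? []       = nothing
findAny p? (x ∷ xs) = Maybe.map here (p? x) <∣> Maybe.map there (findAny p? xs)

HasIsolatedVertex : ∀ {k} → AdjMatrix k → Set
HasIsolatedVertex b = ∃ λ i → ∀ j → b i j ≡ false

HasEdge : ∀ {k} → AdjMatrix k → Set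
HasEdge b = ∃₂ λ i j → b i j ≡ true

Classified : ∀ {k} → AdjMatrix k → Set
Classified b = Any (b ≅_) allowedCCGs ⊎ (HasIsolatedVertex b × HasEdge b)

classify? : ∀ {k} (b : AdjMatrix k) → Maybe (Classified b)
classify? b = Maybe.map inj₂ (dec⇒maybe (isolated? ×-dec edge?)) <∣> Maybe.map inj₁ (findAny (iso? b) allowedCCGs)
  where
  isolated? : Dec (HasIsolatedVertex b)
  isolated? = any? λ i → all? λ j → b i j Bool.≟ false
  edge? : Dec (HasEdge b)
  edge? = any? λ i → any? λ j → b i j Bool.≟ true

Classified-resp : ∀ {k} {b b′ : AdjMatrix k} → b ≐ b′ → Classified b′ → Classified b
Classified-resp b≐b′ (inj₁ iso) = inj₁ (Any.map (λ (σ , pres) → σ , λ i j → trans (b≐b′ i j) (pres i j)) iso)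
Classified-resp b≐b′ (inj₂ ((i , isolated) , (j , l , edge))) =
  inj₂ ((i , λ m → trans (b≐b′ i m) (isolated m)) , (j , l , trans (b≐b′ j l) edge))

∀Bool : (Bool → Bool) → Bool
∀Bool P = P true ∧ P false

∀Row : ∀ k → ((Fin k → Bool) → Bool) → Bool
∀Row zero    P = P (λ ())
∀Row (suc k) P = ∀Bool λ x → ∀Row k λ r → P (x Row.∷ r)

extend : ∀ {k} → AdjMatrix k → (Fin k → Bool) → AdjMatrix (suc k)
extend b r zero    zero    = false
extend b r zero    (suc j) = r j
extend b r (suc i) zero    = r i
extend b r (suc i) (suc j) = b i j

∀Graph : ∀ k → (AdjMatrix k → Bool) → Bool
∀Graph zero    P = P (λ ())
∀Graph (suc k) P = ∀Graph k λ b → ∀Row k λ r → P (extend b r)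

∀Bool-sound : ∀ P → T (∀Bool P) → ∀ x → T (P x)
∀Bool-sound P holds true  = proj₁ (Equivalence.to (Bool.T-∧ {P true}) holds)
∀Bool-sound P holds false = proj₂ (Equivalence.to (Bool.T-∧ {P true}) holds)

-- Without function extensionality, the enumerated row (below: matrix) agrees with the given
-- one only pointwise.
∀Row-sound : ∀ k P → T (∀Row k P) → ∀ r → ∃ λ r′ → r ≗ r′ × T (P r′)
∀Row-sound zero    P holds r = (λ ()) , (λ ()) , holds
∀Row-sound (suc k) P holds r
  with ∀Row-sound k _ (∀Bool-sound (λ x → ∀Row k λ r → P (x Row.∷ r)) holds (r zero)) (r ∘ suc)
... | r′ , r≗r′ , holds′ = r zero Row.∷ r′ , (λ { zero → refl ; (suc i) → r≗r′ i }) , holds′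

∀Graph-sound : ∀ k P → T (∀Graph k P) → ∀ b → IsSymmetric b → IsLoopless b → ∃ λ b′ → b ≐ b′ × T (P b′)
∀Graph-sound zero    P holds b _     _        = (λ ()) , (λ ()) , holds
∀Graph-sound (suc k) P holds b b-sym b-loopless
  with ∀Graph-sound k _ holds (λ i j → b (suc i) (suc j)) (λ i j → b-sym (suc i) (suc j)) (b-loopless ∘ suc)
... | b′ , b≐b′ , holds′ with ∀Row-sound k _ holds′ (b zero ∘ suc)
... | r′ , r≗r′ , holds″ = extend b′ r′ , b≐extend , holds″
  where
  b≐extend : b ≐ extend b′ r′
  b≐extend zero    zero    = b-loopless zero
  b≐extend zero    (suc j) = r≗r′ j
  b≐extend (suc i) zero    = trans (b-sym (suc i) zero) (r≗r′ i)
  b≐extend (suc i) (suc j) = b≐b′ i j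

classified-by-search : ∀ k → T (∀Graph k (is-just ∘ classify?)) →
                       (b : AdjMatrix k) → IsSymmetric b → IsLoopless b → Classified b
classified-by-search k searched b b-sym b-loopless with ∀Graph-sound k _ searched b b-sym b-loopless
... | b′ , b≐b′ , found = Classified-resp b≐b′ (to-witness-T (classify? b′) found)

-- Each tt is accepted by evaluating the exhaustive search ∀Graph k.
classification : ∀ {k} → 0 < k → k ≤ 4 → (b : AdjMatrix k) → IsSymmetric b → IsLoopless b → Classified b
classification {1} _ _ = classified-by-search 1 tt
classification {2} _ _ = classified-by-search 2 tt
classification {3} _ _ = classified-by-search 3 tt
classification {4} _ _ = classified-by-search 4 tt
classification {suc (suc (suc (suc (suc _))))} _ (s≤s (s≤s (s≤s (s≤s ()))))

classify-decidable : ∀ {k} {R : Fin k → Fin k → Set} → (∀ i j → Dec (R i j)) → (∀ {i j} → R i j → R j i) →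
                     (∀ i → ¬ R i i) → 0 < k → k ≤ 4 →
                     Any (IsoTo R) allowedCCGs ⊎ ((∃ λ i → ∀ j → ¬ R i j) × ∃₂ R)
classify-decidable {R = R} R? R-sym R-irrefl 0<k k≤4
  with classification 0<k k≤4 (λ i j → does (R? i j))
                      (λ i j → does-⇔ (mk⇔ R-sym R-sym) (R? i j) (R? j i)) (λ i → dec-false (R? i i) (R-irrefl i))
... | inj₁ iso = inj₁ (Any.map (λ (σ , pres) → σ , λ i j →
                   subst (λ x → R i j ⇔ x ≡ true) (pres i j) (mk⇔ (dec-true (R? i j)) (does≡true⇒ (R? i j))))
                 iso)
... | inj₂ ((i , isolated) , (j , l , edge)) =
  inj₂ ((i , λ m → does≡false⇒¬ (R? i m) (isolated m)) , (j , l , does≡true⇒ (R? j l) edge))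

lemma6 : ∀ {n} (G : Graph n) → Subcubic G →
         ∀ {k} (π : Partition G k) → IsConnCoalitionPartition G π → k ≤ 4 →
         Any (IsoTo (CCGAdj G π)) allowedCCGs
lemma6 G (connected , deg≤3) π coalition-partition k≤4
  with classify-decidable (ccgAdj? G π) (ccgAdj-sym G π) (λ i (i≢i , _) → i≢i refl) 0<k k≤4
  where
  0<k : 0 < _
  0<k = ≤-<-trans z≤n (toℕ<n (cls π (proj₁ (proj₁ connected))))
... | inj₁ allowed = allowed
... | inj₂ ((i , i-isolated) , (j , l , j~l)) =
  ⊥-elim (isolated-class⇒no-coalition G π deg≤3 coalition-partition i-isolated j~l)
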